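{- Let $\mathcal{P}=(Q,T)$ be a replicated system and $U\subseteq T$. Then $[\![\mathrm{dis}(U)]\!]=[\![\mathrm{dead}(U)]\!]$ if and only if $$\bigwedge_{t\in T}\ \bigwedge_{u\in U}\ \bigvee_{u'\in U}\ \mathrm{pre}(t)+(\mathrm{pre}(u)\mathbin{\dot- }\mathrm{post}(t))\ \ge\ \mathrm{pre}(u')$$ holds (inequalities componentwise).
   Context: A replicated system of arity $n$ over a finite set $Q$ is a pair $\mathcal{P}=(Q,T)$ with $T\subseteq\bigcup_{k=0}^n Q^{(k)}\times Q^{(k)}$ ($Q^{(k)}$ = multisets over $Q$ of size $k$), containing every silent pair $(x,x)$, $x\in Q^{(k)}$, $k\le n$. Configurations are multisets $C\in\mathbb{N}^Q$. For $t=(x,y)\in T$ put $\mathrm{pre}(t)=x$, $\mathrm{post}(t)=y$; $t$ is enabled at $C$ if $C\ge\mathrm{pre}(t)$ componentwise (otherwise disabled), and then $C\xrightarrow{t}C-\mathrm{pre}(t)+\mathrm{post}(t)$. A transition is dead at $C$ if it is disabled at every configuration reachable from $C$ (including $C$). $[\![\mathrm{dis}(U)]\!]$ is the set of configurations at which all transitions of $U$ are disabled; $[\![\mathrm{dead}(U)]\!]$ the set at which all transitions of $U$ are dead. For $\mathbf{x},\mathbf{y}\in\mathbb{N}^Q$, $(\mathbf{x}\mathbin{\dot- }\mathbf{y})(q)=\max(\mathbf{x}(q)-\mathbf{y}(q),0)$. -}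

module Defs where

open import Data.Nat using (ℕ; _+_; _∸_; _≤_)
open import Data.Vec using (Vec; zipWith)
open import Data.Vec.Relation.Binary.Pointwise.Inductive using (Pointwise)
open import Data.List using (List)
open import Data.List.Relation.Unary.All using (All)
open import Data.List.Relation.Unary.Any using (Any)
open import Data.List.Membership.Propositional using (_∈_)
open import Data.Product using (_×_; _,_; proj₁; proj₂)
open import Relation.Nullary using (¬_)
open import Relation.Binary.Construct.Closure.ReflexiveTransitive using (Star)
import Data.Vec as V
open import Relation.Binary.PropositionalEquality using (_≡_)

-- States Q = Fin m; a multiset over Q (and a configuration) is a vector in ℕ^m.
Multiset : ℕ → Set
Multiset m = Vec ℕ m

size : ∀ {m} → Multiset m → ℕ
size = V.sum

_≤ᵐ_ : ∀ {m} → Multiset m → Multiset m → Set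
x ≤ᵐ y = Pointwise _≤_ x y

_+ᵐ_ : ∀ {m} → Multiset m → Multiset m → Multiset m
_+ᵐ_ = zipWith _+_

_∸ᵐ_ : ∀ {m} → Multiset m → Multiset m → Multiset m
_∸ᵐ_ = zipWith _∸_

Transition : ℕ → Set
Transition m = Multiset m × Multiset m

pre post : ∀ {m} → Transition m → Multiset m
pre = proj₁
post = proj₂

record ReplicatedSystem (m n : ℕ) : Set where
  field
    T      : List (Transition m)
    arity  : All (λ t → size (pre t) ≡ size (post t) × size (pre t) ≤ n) T
    silent : ∀ (x : Multiset m) → size x ≤ n → (x , x) ∈ T

Configuration : ℕ → Set
Configuration = Multiset

Enabled : ∀ {m} → Transition m → Configuration m → Set
Enabled t C = pre t ≤ᵐ C

Disabled : ∀ {m} → Transition m → Configuration m → Set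
Disabled t C = ¬ Enabled t C

module _ {m n : ℕ} (P : ReplicatedSystem m n) where
  open ReplicatedSystem P

  data Step : Configuration m → Configuration m → Set where
    step : ∀ {C} (t : Transition m) → t ∈ T → Enabled t C →
           Step C ((C ∸ᵐ pre t) +ᵐ post t)

  Reachable : Configuration m → Configuration m → Set
  Reachable = Star Step

  Dead : Transition m → Configuration m → Set
  Dead t C = ∀ C′ → Reachable C C′ → Disabled t C′

  dis : List (Transition m) → Configuration m → Set
  dis U C = All (λ u → Disabled u C) U

  dead : List (Transition m) → Configuration m → Set
  dead U C = All (λ u → Dead u C) U

  Criterion : List (Transition m) → Set
  Criterion U = All (λ t → All (λ u → Any (λ u′ →
                  pre u′ ≤ᵐ (pre t +ᵐ (pre u ∸ᵐ post t))) U) U) T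

module Submission where

-- For transitions t and u let  W(t,u) = pre(t) + (pre(u) ∸ post(t)).
-- This "witness" is the least configuration at which t is enabled and whose
-- t-successor enables u: every C with the same two properties satisfies
-- W(t,u) ≤ C.  Since enabledness is upward closed, the criterion says exactly
-- that firing any t from a configuration of [[dis(U)]] can never enable a u ∈ U.
--
-- (⇐) Under the criterion [[dis(U)]] is closed under steps, hence under
--     reachability, so dis(U) implies dead(U); dead(U) ⇒ dis(U) always holds.
-- (⇒) At W(t,u), firing t enables u, so u is not dead; by the assumed equality
--     some u′ ∈ U is enabled at W(t,u), which is the required disjunct
--     (found by deciding the finite disjunction).

open import Defs
open import Data.Nat using (ℕ; _+_; _∸_; _≤_; _≤?_)
open import Data.Nat.Properties
  using (≤-trans; m≤m+n; m≤n+m∸n; m+n∸n≡m; m+n∸m≡n; m+[n∸m]≡n; +-comm; +-monoʳ-≤; ∸-monoˡ-≤)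
open import Data.Vec using ([]; _∷_)
open import Data.Vec.Relation.Binary.Pointwise.Inductive using ([]; _∷_; decidable)
import Data.Vec.Relation.Binary.Pointwise.Inductive as Pointwise
open import Data.List using (List)
open import Data.List.Relation.Unary.All using (All; tabulate; lookup)
import Data.List.Relation.Unary.All as All
open import Data.List.Relation.Unary.All.Properties using (¬Any⇒All¬; All¬⇒¬Any)
open import Data.List.Relation.Unary.Any using (Any; any?)
open import Data.List.Membership.Propositional using (_∈_)
open import Data.Empty using (⊥-elim)
open import Data.Product using (_,_)
open import Function using (_∘_; id)
open import Function.Bundles using (_⇔_; mk⇔; Equivalence)
open import Relation.Nullary using (Dec; yes; no)
open import Relation.Binary.PropositionalEquality using (sym; subst)
open import Relation.Binary.Construct.Closure.ReflexiveTransitive using (ε; _◅_; fold)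

fire : ∀ {m} → Transition m → Configuration m → Configuration m
fire t C = (C ∸ᵐ pre t) +ᵐ post t

-- The least configuration enabling t whose t-successor enables u.
witness : ∀ {m} → Transition m → Transition m → Configuration m
witness t u = pre t +ᵐ (pre u ∸ᵐ post t)

witness-enough : ∀ a p q → a ≤ ((p + (a ∸ q)) ∸ p) + q
witness-enough a p q =
  subst (λ z → a ≤ z + q) (sym (m+n∸m≡n p (a ∸ q)))
    (subst (a ≤_) (+-comm q (a ∸ q)) (m≤n+m∸n a q))

witness-least : ∀ a c p q → a ≤ (c ∸ p) + q → p ≤ c → p + (a ∸ q) ≤ c
witness-least a c p q a≤succ p≤c = subst (p + (a ∸ q) ≤_) (m+[n∸m]≡n p≤c) (+-monoʳ-≤ p a∸q≤c∸p)
  where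
    a∸q≤c∸p : a ∸ q ≤ c ∸ p
    a∸q≤c∸p = subst (a ∸ q ≤_) (m+n∸n≡m (c ∸ p) q) (∸-monoˡ-≤ q a≤succ)

≤ᵐ-trans : ∀ {m} {x y z : Multiset m} → x ≤ᵐ y → y ≤ᵐ z → x ≤ᵐ z
≤ᵐ-trans = Pointwise.trans ≤-trans

-- Enabledness is decidable, so the finite disjunction of the criterion is too.
_≤ᵐ?_ : ∀ {m} (x y : Multiset m) → Dec (x ≤ᵐ y)
_≤ᵐ?_ = decidable _≤?_

≤ᵐ-+ᵐ : ∀ {m} (x y : Multiset m) → x ≤ᵐ (x +ᵐ y)
≤ᵐ-+ᵐ []       []       = []
≤ᵐ-+ᵐ (x ∷ xs) (y ∷ ys) = m≤m+n x y ∷ ≤ᵐ-+ᵐ xs ys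

witness-enables-t : ∀ {m} (t u : Transition m) → Enabled t (witness t u)
witness-enables-t t u = ≤ᵐ-+ᵐ (pre t) (pre u ∸ᵐ post t)

witness-enables-u : ∀ {m} (t u : Transition m) → Enabled u (fire t (witness t u))
witness-enables-u (p , q) (a , _) = go a p q
  where
    go : ∀ {k} (a p q : Multiset k) → a ≤ᵐ (((p +ᵐ (a ∸ᵐ q)) ∸ᵐ p) +ᵐ q)
    go []       []       []       = []
    go (a ∷ as) (p ∷ ps) (q ∷ qs) = witness-enough a p q ∷ go as ps qs

witness-below : ∀ {m} (t u : Transition m) (C : Configuration m) →
                Enabled u (fire t C) → Enabled t C → witness t u ≤ᵐ C
witness-below (p , q) (a , _) C = go a C p q
  where
    go : ∀ {k} (a c p q : Multiset k) → a ≤ᵐ ((c ∸ᵐ p) +ᵐ q) → p ≤ᵐ c → (p +ᵐ (a ∸ᵐ q)) ≤ᵐ c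
    go []       []       []       []       []         []         = []
    go (a ∷ as) (c ∷ cs) (p ∷ ps) (q ∷ qs) (h ∷ hs) (e ∷ es) = witness-least a c p q h e ∷ go as cs ps qs hs es

module _ {m n : ℕ} (P : ReplicatedSystem m n) (U : List (Transition m)) where
  open ReplicatedSystem P

  -- Under the criterion, no step leads from [[dis(U)]] out of [[dis(U)]]: if firing t
  -- at C enabled u, then some u′ ∈ U is enabled at W(t,u) ≤ C, hence at C.
  dis-step-closed : Criterion P U → ∀ {C C′} → Step P C C′ → dis P U C → dis P U C′
  dis-step-closed crit {C} (step t t∈T t-enabled) disC = tabulate u-disabled
    where
      u-disabled : ∀ {u} → u ∈ U → Disabled u (fire t C)
      u-disabled {u} u∈U u-enabled =
        All¬⇒¬Any (All.map (λ u′-disabled → u′-disabled ∘ (λ below-W → ≤ᵐ-trans below-W W≤C)) disC)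
                  (lookup (lookup crit t∈T) u∈U)
        where
          W≤C : witness t u ≤ᵐ C
          W≤C = witness-below t u C u-enabled t-enabled

  dis-reachable-closed : Criterion P U → ∀ {C C′} → Reachable P C C′ → dis P U C → dis P U C′
  dis-reachable-closed crit = fold (λ X Y → dis P U X → dis P U Y) (λ s k → k ∘ dis-step-closed crit s) id

  dis⇒dead : Criterion P U → ∀ C → dis P U C → dead P U C
  dis⇒dead crit C disC = tabulate λ u∈U C′ C→C′ → lookup (dis-reachable-closed crit C→C′ disC) u∈U

  dead⇒dis : ∀ C → dead P U C → dis P U C
  dead⇒dis C = All.map (λ u-dead → u-dead C ε)

  -- If dis(U) and dead(U) coincide, then at every witness W(t,u) some u′ ∈ U is
  -- enabled: otherwise W(t,u) ∈ [[dis(U)]] = [[dead(U)]], yet firing t enables u.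
  criterion-from-equality : (∀ C → dis P U C ⇔ dead P U C) → Criterion P U
  criterion-from-equality dis⇔dead = tabulate λ {t} t∈T → tabulate λ {u} u∈U → some-enabled t t∈T u u∈U
    where
      some-enabled : ∀ t → t ∈ T → ∀ u → u ∈ U → Any (λ u′ → pre u′ ≤ᵐ witness t u) U
      some-enabled t t∈T u u∈U with any? (λ u′ → pre u′ ≤ᵐ? witness t u) U
      ... | yes enabled = enabled
      ... | no none-enabled =
        ⊥-elim (lookup (Equivalence.to (dis⇔dead (witness t u)) (¬Any⇒All¬ U none-enabled)) u∈U
                       (fire t (witness t u)) (step t t∈T (witness-enables-t t u) ◅ ε)
                       (witness-enables-u t u))

proposition10 : ∀ {m n : ℕ} (P : ReplicatedSystem m n) (U : List (Transition m)) →
                All (_∈ ReplicatedSystem.T P) U →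
                ((∀ (C : Configuration m) → dis P U C ⇔ dead P U C) ⇔ Criterion P U)
proposition10 P U _ =
  mk⇔ (criterion-from-equality P U)
      (λ crit C → mk⇔ (dis⇒dead P U crit C) (dead⇒dis P U C))
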